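{- Let $r_2\ge 3$ be an odd integer. Then there is no finite simple graph with parameters $(r_2,r_3)$ for any integer $r_3$ with $\binom{r_2-1}{2}<r_3<\binom{r_2}{2}$. Moreover, $K_{r_2+1}$ has parameters $\bigl(r_2,\binom{r_2}{2}\bigr)$ and $K_{r_2}\square K_2$ has parameters $\bigl(r_2,\binom{r_2-1}{2}\bigr)$.
   Context: For a vertex $v$, its $K_3$-degree is the number of triangles of the graph containing $v$. A graph has parameters $(r_2,r_3)$ if every vertex has degree $r_2$ and every vertex has $K_3$-degree $r_3$. $K_n$ is the complete graph on $n$ vertices. $G\square H$ is the Cartesian product: vertex set $V(G)\times V(H)$, with $(u,v)\sim(u',v')$ iff ($u=u'$ and $vv'\in E(H)$) or ($v=v'$ and $uu'\in E(G)$). -}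

module Defs where

open import Data.Nat using (ℕ; zero; suc; _+_; _*_)
open import Data.Bool using (Bool; true; false; _∧_; _∨_; not; if_then_else_)
open import Data.Fin using (Fin; remQuot)
open import Data.Fin.Properties using (_≟_; _<?_)
open import Data.List using (List; map)
open import Data.Nat.ListAction using (sum)
open import Data.List using () renaming (allFin to allFinL)
open import Data.Product using (_×_; _,_; proj₁; proj₂)
open import Relation.Nullary.Decidable using (⌊_⌋)
open import Relation.Binary.PropositionalEquality using (_≡_)

record Graph (n : ℕ) : Set where
  field
    adj    : Fin n → Fin n → Bool
    sym    : ∀ i j → adj i j ≡ adj j i
    irrefl : ∀ i → adj i i ≡ false
open Graph public

[_] : Bool → ℕ
[ b ] = if b then 1 else 0

∑ : (n : ℕ) → (Fin n → ℕ) → ℕ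
∑ n f = sum (map f (allFinL n))

degree : ∀ {n} → Graph n → Fin n → ℕ
degree {n} G v = ∑ n (λ j → [ adj G v j ])

k3degree : ∀ {n} → Graph n → Fin n → ℕ
k3degree {n} G v =
  ∑ n (λ j → ∑ n (λ k →
    [ ⌊ j <? k ⌋ ∧ adj G v j ∧ adj G v k ∧ adj G j k ]))

HasParams : ∀ {n} → Graph n → ℕ → ℕ → Set
HasParams {n} G r₂ r₃ = ∀ (v : Fin n) → degree G v ≡ r₂ × k3degree G v ≡ r₃

K : (m : ℕ) → Graph m
K m = record
  { adj    = λ i j → not ⌊ i ≟ j ⌋
  ; sym    = λ i j → symK i j
  ; irrefl = λ i → irrK i
  }
  where
  open import Relation.Binary.PropositionalEquality using (refl; cong) renaming (sym to ≡sym)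
  open import Relation.Nullary using (yes; no)
  open import Data.Empty using (⊥-elim)
  symK : ∀ (i j : Fin m) → not ⌊ i ≟ j ⌋ ≡ not ⌊ j ≟ i ⌋
  symK i j with i ≟ j | j ≟ i
  ... | yes _ | yes _ = refl
  ... | no _  | no _  = refl
  ... | yes p | no q  = ⊥-elim (q (≡sym p))
  ... | no p  | yes q = ⊥-elim (p (≡sym q))
  irrK : ∀ (i : Fin m) → not ⌊ i ≟ i ⌋ ≡ false
  irrK i with i ≟ i
  ... | yes _ = refl
  ... | no p  = ⊥-elim (p refl)

-- Cartesian product G □ H on vertex set Fin (m * n) ≅ Fin m × Fin n
-- (identification via Data.Fin.remQuot / combine, a bijection).
_□_ : ∀ {m n} → Graph m → Graph n → Graph (m * n)
_□_ {m} {n} G H = record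
  { adj    = λ x y → A (remQuot n x) (remQuot n y)
  ; sym    = λ x y → symA (remQuot n x) (remQuot n y)
  ; irrefl = λ x → irrA (remQuot n x)
  }
  where
  open import Relation.Binary.PropositionalEquality using (refl; cong; cong₂; trans) renaming (sym to ≡sym)
  open import Relation.Nullary using (yes; no)
  open import Data.Empty using (⊥-elim)
  open import Data.Bool.Properties using (∨-comm)
  A : Fin m × Fin n → Fin m × Fin n → Bool
  A (u , v) (u' , v') = (⌊ u ≟ u' ⌋ ∧ adj H v v') ∨ (⌊ v ≟ v' ⌋ ∧ adj G u u')
  eqb : ∀ {k} (a b : Fin k) → ⌊ a ≟ b ⌋ ≡ ⌊ b ≟ a ⌋
  eqb a b with a ≟ b | b ≟ a
  ... | yes _ | yes _ = refl
  ... | no _  | no _  = refl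
  ... | yes p | no q  = ⊥-elim (q (≡sym p))
  ... | no p  | yes q = ⊥-elim (p (≡sym q))
  eqt : ∀ {k} (a : Fin k) → ⌊ a ≟ a ⌋ ≡ true
  eqt a with a ≟ a
  ... | yes _ = refl
  ... | no p  = ⊥-elim (p refl)
  symA : ∀ p q → A p q ≡ A q p
  symA (u , v) (u' , v') =
    cong₂ _∨_ (cong₂ _∧_ (eqb u u') (Graph.sym H v v'))
              (cong₂ _∧_ (eqb v v') (Graph.sym G u u'))
  irrA : ∀ p → A p p ≡ false
  irrA (u , v) rewrite eqt u | eqt v | Graph.irrefl H v | Graph.irrefl G u = refl

module Submission where

-- Let G be d-regular with constant K₃-degree r₃ and d odd, and let W(v) count the ordered
-- pairs of non-adjacent neighbours of v, the d pairs (u, u) included. Then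
-- W(v) = d² − 2r₃ is the same odd number W for every vertex, and the gap hypothesis on r₃
-- says d + 2 ≤ W ≤ 3d − 4.
-- Fix an edge vx with L common neighbours; each end has P = d − L further neighbours.
-- A common neighbour has only d neighbours among the d + P vertices of N(v) ∪ N(x), so it
-- misses at least P of them; inside N(v) ∖ N(x), which contains x and no neighbour of x,
-- there are at least 3P − 2 missing pairs, and likewise inside N(x) ∖ N(v). Hence
-- 2P(L + 3) ≤ W(v) + W(x) + 4, i.e. P(L + 3) ≤ W + 2, and W odd with W ≤ 3d − 4 leaves
-- only (d + 1)P ≤ W + 1. The values of P over the d neighbours x of v add up to W, so
-- (d + 1)W ≤ d(W + 1), i.e. W ≤ d: a contradiction.
-- In K_{r+1} the only missing pairs are the diagonal ones, and a triangle of G □ K₂ lies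
-- in one layer, so G □ K₂ has parameters (r + 1, r₃) when G has parameters (r, r₃).

open import Defs hiding (sym)
open import Data.Bool using (Bool; true; false; _∧_; _∨_; not; if_then_else_)
open import Data.Bool.Properties
  using (∧-comm; ∧-assoc; ∧-idem; ∧-zeroʳ; ∧-identityʳ; ∨-identityʳ; not-involutive)
open import Data.Fin using (Fin; zero; suc; punchIn; punchOut; remQuot; _↑ˡ_; _↑ʳ_)
open import Data.Fin.Patterns using (0F; 1F)
open import Data.Fin.Properties
  using (_≟_; _<?_; <-asym; <-cmp; punchInᵢ≢i; punchIn-punchOut; splitAt-↑ˡ; splitAt-↑ʳ)
open import Data.List using (tabulate)
open import Data.List.Properties using (map-tabulate)
import Data.Nat.ListAction as List
open import Data.Nat using (ℕ; zero; suc; _+_; _*_; _∸_; _≤_; _<_; z≤n; z<s)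
open import Data.Nat.Combinatorics using (_C_; nC1≡n; nCk+nC[k+1]≡[n+1]C[k+1])
open import Data.Nat.Properties hiding (_≟_; _<?_; <-asym; <-cmp)
open import Algebra.Properties.Semiring.Sum +-*-semiring
  using (sum; sum-cong-≗; sum-replicate-zero; sum-remove; ∑-distrib-+; ∑-comm; *-distribˡ-sum; *-distribʳ-sum)
open import Data.Nat.Tactic.RingSolver using (solve-∀)
open import Data.Product using (∃; _×_; _,_; proj₁; proj₂)
open import Function using (_∘_; id)
open import Relation.Binary.Definitions using (tri<; tri≈; tri>)
open import Relation.Binary.PropositionalEquality hiding ([_])
open import Relation.Nullary using (¬_; yes; no; contradiction)
open import Relation.Nullary.Decidable using (⌊_⌋)

∑≡sum : ∀ n (f : Fin n → ℕ) → ∑ n f ≡ sum f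
∑≡sum zero    f = refl
∑≡sum (suc n) f = cong (f zero +_) (begin
  List.sum (Data.List.map f (tabulate suc))   ≡⟨ cong List.sum (map-tabulate suc f) ⟩
  List.sum (tabulate (f ∘ suc))               ≡⟨ cong List.sum (map-tabulate id (f ∘ suc)) ⟨
  ∑ n (f ∘ suc)                               ≡⟨ ∑≡sum n (f ∘ suc) ⟩
  sum (f ∘ suc)                               ∎)
  where open ≡-Reasoning

sum-mono-≤ : ∀ {n} {f g : Fin n → ℕ} → (∀ i → f i ≤ g i) → sum f ≤ sum g
sum-mono-≤ {zero}  _   = z≤n
sum-mono-≤ {suc n} f≤g = +-mono-≤ (f≤g zero) (sum-mono-≤ (f≤g ∘ suc))

≤-sum : ∀ {n} (f : Fin n → ℕ) i → f i ≤ sum f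
≤-sum {suc n} f i = ≤-trans (m≤m+n (f i) _) (≤-reflexive (sym (sum-remove {i = i} f)))

≟-refl : ∀ {n} (i : Fin n) → ⌊ i ≟ i ⌋ ≡ true
≟-refl i = cong ⌊_⌋ (≡-≟-identity _≟_ refl)

≟-≢ : ∀ {n} {i j : Fin n} → i ≢ j → ⌊ i ≟ j ⌋ ≡ false
≟-≢ i≢j = cong ⌊_⌋ (≢-≟-identity _≟_ i≢j)

sum-select : ∀ {n} (i : Fin n) (f : Fin n → ℕ) → sum (λ j → [ ⌊ i ≟ j ⌋ ] * f j) ≡ f i
sum-select {suc n} i f = begin
  sum (λ j → [ ⌊ i ≟ j ⌋ ] * f j)
    ≡⟨ sum-remove {i = i} (λ j → [ ⌊ i ≟ j ⌋ ] * f j) ⟩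
  [ ⌊ i ≟ i ⌋ ] * f i + sum (λ k → [ ⌊ i ≟ punchIn i k ⌋ ] * f (punchIn i k))
    ≡⟨ cong₂ _+_ (cong (λ b → [ b ] * f i) (≟-refl i)) (trans (sum-cong-≗ off-diagonal) (sum-replicate-zero n)) ⟩
  1 * f i + 0
    ≡⟨ trans (+-identityʳ _) (*-identityˡ _) ⟩
  f i
    ∎
  where
  open ≡-Reasoning
  off-diagonal : ∀ k → [ ⌊ i ≟ punchIn i k ⌋ ] * f (punchIn i k) ≡ 0
  off-diagonal k = cong (λ b → [ b ] * f (punchIn i k)) (≟-≢ (punchInᵢ≢i i k ∘ sym))

sum₂ : ∀ {n} → (Fin n → Fin n → ℕ) → ℕ
sum₂ f = sum λ u → sum λ y → f u y

sum₂-cong : ∀ {n} {f g : Fin n → Fin n → ℕ} → (∀ u y → f u y ≡ g u y) → sum₂ f ≡ sum₂ g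
sum₂-cong f≡g = sum-cong-≗ λ u → sum-cong-≗ (f≡g u)

sum₂-distrib-+ : ∀ {n} (f g : Fin n → Fin n → ℕ) → sum₂ (λ u y → f u y + g u y) ≡ sum₂ f + sum₂ g
sum₂-distrib-+ f g =
  trans (sum-cong-≗ λ u → ∑-distrib-+ (f u) (g u)) (∑-distrib-+ (λ u → sum (f u)) (λ u → sum (g u)))

sum₂-* : ∀ {n} (f g : Fin n → ℕ) → sum₂ (λ u y → f u * g y) ≡ sum f * sum g
sum₂-* f g = trans (sum-cong-≗ λ u → sym (*-distribˡ-sum (f u) g)) (sym (*-distribʳ-sum (sum g) f))

sum-↑ : ∀ m {n} (f : Fin (m + n) → ℕ) → sum f ≡ sum (f ∘ (_↑ˡ n)) + sum (f ∘ (m ↑ʳ_))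
sum-↑ zero    f = refl
sum-↑ (suc m) f = trans (cong (f zero +_) (sum-↑ m (f ∘ suc))) (sym (+-assoc (f zero) _ _))

sum-remQuot : ∀ m {n} (g : Fin m × Fin n → ℕ) → sum (g ∘ remQuot n) ≡ sum λ i → sum λ j → g (i , j)
sum-remQuot zero    g = refl
sum-remQuot (suc m) {n} g = begin
  sum (g ∘ remQuot n)
    ≡⟨ sum-↑ n (g ∘ remQuot n) ⟩
  sum (g ∘ remQuot n ∘ (_↑ˡ (m * n))) + sum (g ∘ remQuot n ∘ (n ↑ʳ_))
    ≡⟨ cong₂ _+_ (sum-cong-≗ λ j → cong g (remQuot-↑ˡ j)) (sum-cong-≗ λ k → cong g (remQuot-↑ʳ k)) ⟩
  sum (λ j → g (zero , j)) + sum (λ k → g (suc (proj₁ (remQuot {m} n k)) , proj₂ (remQuot {m} n k)))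
    ≡⟨ cong (sum (λ j → g (zero , j)) +_) (sum-remQuot m (λ (i , j) → g (suc i , j))) ⟩
  sum (λ j → g (zero , j)) + sum (λ i → sum λ j → g (suc i , j))
    ∎
  where
  open ≡-Reasoning
  remQuot-↑ˡ : ∀ j → remQuot {suc m} n (j ↑ˡ (m * n)) ≡ (zero , j)
  remQuot-↑ˡ j rewrite splitAt-↑ˡ n j (m * n) = refl
  remQuot-↑ʳ : ∀ k → remQuot {suc m} n (n ↑ʳ k) ≡ (suc (proj₁ (remQuot {m} n k)) , proj₂ (remQuot {m} n k))
  remQuot-↑ʳ k rewrite splitAt-↑ʳ n (m * n) k = refl

[∧]≡[]*[] : ∀ a b → [ a ∧ b ] ≡ [ a ] * [ b ]
[∧]≡[]*[] false b = refl
[∧]≡[]*[] true  b = sym (+-identityʳ [ b ])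

[∧∧]≡[]*[]*[] : ∀ a b c → [ a ∧ b ∧ c ] ≡ [ a ] * [ b ] * [ c ]
[∧∧]≡[]*[]*[] a b c =
  trans ([∧]≡[]*[] a (b ∧ c)) (trans (cong ([ a ] *_) ([∧]≡[]*[] b c)) (sym (*-assoc [ a ] [ b ] [ c ])))

[]*[]≡[] : ∀ a → [ a ] * [ a ] ≡ [ a ]
[]*[]≡[] false = refl
[]*[]≡[] true  = refl

[]+[not]≡1 : ∀ a → [ a ] + [ not a ] ≡ 1
[]+[not]≡1 false = refl
[]+[not]≡1 true  = refl

[]≡[∧]+[∧not] : ∀ a b → [ a ] ≡ [ a ∧ b ] + [ a ∧ not b ]
[]≡[∧]+[∧not] false b     = refl
[]≡[∧]+[∧not] true  false = refl
[]≡[∧]+[∧not] true  true  = refl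

[∨]≡[∧]+[∧not]+[∧not] : ∀ a b → [ a ∨ b ] ≡ [ a ∧ b ] + [ a ∧ not b ] + [ b ∧ not a ]
[∨]≡[∧]+[∧not]+[∧not] false false = refl
[∨]≡[∧]+[∧not]+[∧not] false true  = refl
[∨]≡[∧]+[∧not]+[∧not] true  false = refl
[∨]≡[∧]+[∧not]+[∧not] true  true  = refl

[]≤[∧not]+[] : ∀ a b → [ a ] ≤ [ a ∧ not b ] + [ b ]
[]≤[∧not]+[] false b     = z≤n
[]≤[∧not]+[] true  false = ≤-refl
[]≤[∧not]+[] true  true  = ≤-refl

[]*-monoʳ-≤ : ∀ a {m n} → (a ≡ true → m ≤ n) → [ a ] * m ≤ [ a ] * n
[]*-monoʳ-≤ false _   = z≤n
[]*-monoʳ-≤ true  m≤n = +-monoˡ-≤ 0 (m≤n refl)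

Subset : ℕ → Set
Subset n = Fin n → Bool

infixr 7 _∩_
infixr 6 _∪_ _∖_

_∩_ _∪_ _∖_ : ∀ {n} → Subset n → Subset n → Subset n
(X ∩ Y) i = X i ∧ Y i
(X ∪ Y) i = X i ∨ Y i
(X ∖ Y) i = X i ∧ not (Y i)

count : ∀ {n} → Subset n → ℕ
count X = sum λ i → [ X i ]

count-∩+∖ : ∀ {n} (X Y : Subset n) → count (X ∩ Y) + count (X ∖ Y) ≡ count X
count-∩+∖ X Y = trans (sym (∑-distrib-+ (λ i → [ X i ∧ Y i ]) (λ i → [ X i ∧ not (Y i) ])))
                      (sum-cong-≗ λ i → sym ([]≡[∧]+[∧not] (X i) (Y i)))

count-∪ : ∀ {n} (X Y : Subset n) → count (X ∪ Y) ≡ count (X ∩ Y) + count (X ∖ Y) + count (Y ∖ X)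
count-∪ X Y = begin
  count (X ∪ Y)
    ≡⟨ sum-cong-≗ (λ i → [∨]≡[∧]+[∧not]+[∧not] (X i) (Y i)) ⟩
  sum (λ i → ∩∖ i + [ Y i ∧ not (X i) ])
    ≡⟨ ∑-distrib-+ ∩∖ (λ i → [ Y i ∧ not (X i) ]) ⟩
  sum ∩∖ + count (Y ∖ X)
    ≡⟨ cong (_+ count (Y ∖ X)) (∑-distrib-+ (λ i → [ X i ∧ Y i ]) (λ i → [ X i ∧ not (Y i) ])) ⟩
  count (X ∩ Y) + count (X ∖ Y) + count (Y ∖ X)
    ∎
  where
  open ≡-Reasoning
  ∩∖ : _ → ℕ
  ∩∖ i = [ X i ∧ Y i ] + [ X i ∧ not (Y i) ]

count-≤-∖+ : ∀ {n} (X Y : Subset n) → count X ≤ count (X ∖ Y) + count Y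
count-≤-∖+ X Y = ≤-trans (sum-mono-≤ λ i → []≤[∧not]+[] (X i) (Y i))
                         (≤-reflexive (∑-distrib-+ (λ i → [ X i ∧ not (Y i) ]) (λ i → [ Y i ])))

count-full : ∀ n → count {n} (λ _ → true) ≡ n
count-full zero    = refl
count-full (suc n) = cong suc (count-full n)

count-singleton : ∀ {n} (i : Fin n) → count (λ j → ⌊ i ≟ j ⌋) ≡ 1
count-singleton i = trans (sum-cong-≗ λ j → sym (*-identityʳ [ ⌊ i ≟ j ⌋ ])) (sum-select i (λ _ → 1))

count-all-but : ∀ {n} (i : Fin (suc n)) → count (λ j → not ⌊ i ≟ j ⌋) ≡ n
count-all-but {n} i = begin
  count (λ j → not ⌊ i ≟ j ⌋)
    ≡⟨ sum-remove {i = i} (λ j → [ not ⌊ i ≟ j ⌋ ]) ⟩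
  [ not ⌊ i ≟ i ⌋ ] + count (λ k → not ⌊ i ≟ punchIn i k ⌋)
    ≡⟨ cong₂ _+_ (cong (λ b → [ not b ]) (≟-refl i))
                 (sum-cong-≗ λ k → cong (λ b → [ not b ]) (≟-≢ (punchInᵢ≢i i k ∘ sym))) ⟩
  count {n} (λ _ → true)
    ≡⟨ count-full n ⟩
  n ∎
  where open ≡-Reasoning

count-two : ∀ {n} {X : Subset n} {i j} → i ≢ j → X i ≡ true → X j ≡ true → 2 ≤ count X
count-two {suc n} {X} {i} {j} i≢j Xi Xj = begin
  1 + 1                              ≡⟨ cong (λ b → 1 + [ b ]) (trans (cong X (punchIn-punchOut i≢j)) Xj) ⟨
  1 + [ X (punchIn i k) ]            ≤⟨ +-monoʳ-≤ 1 (≤-sum (λ k → [ X (punchIn i k) ]) k) ⟩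
  1 + count (X ∘ punchIn i)          ≡⟨ cong (λ b → [ b ] + count (X ∘ punchIn i)) Xi ⟨
  [ X i ] + count (X ∘ punchIn i)    ≡⟨ sum-remove {i = i} (λ j → [ X j ]) ⟨
  count X                            ∎
  where
  open ≤-Reasoning
  k = punchOut i≢j

module _ {n} (G : Graph n) where

  edges nonEdges : Subset n → Subset n → ℕ
  edges    X Y = sum₂ λ u y → [ X u ] * [ Y y ] * [ adj G u y ]
  nonEdges X Y = sum₂ λ u y → [ X u ] * [ Y y ] * [ not (adj G u y) ]

  edges+nonEdges : ∀ X Y → edges X Y + nonEdges X Y ≡ count X * count Y
  edges+nonEdges X Y = begin
    edges X Y + nonEdges X Y                 ≡⟨ sum₂-distrib-+ (λ u y → XY u y * [ adj G u y ])
                                                               (λ u y → XY u y * [ not (adj G u y) ]) ⟨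
    sum₂ (λ u y → XY u y * [ adj G u y ] + XY u y * [ not (adj G u y) ])
                                             ≡⟨ sum₂-cong pointwise ⟩
    sum₂ XY                                  ≡⟨ sum₂-* (λ u → [ X u ]) (λ y → [ Y y ]) ⟩
    count X * count Y                        ∎
    where
    open ≡-Reasoning
    XY : Fin n → Fin n → ℕ
    XY u y = [ X u ] * [ Y y ]
    pointwise : ∀ u y → XY u y * [ adj G u y ] + XY u y * [ not (adj G u y) ] ≡ XY u y
    pointwise u y = begin
      XY u y * [ adj G u y ] + XY u y * [ not (adj G u y) ]   ≡⟨ *-distribˡ-+ (XY u y) _ _ ⟨
      XY u y * ([ adj G u y ] + [ not (adj G u y) ])          ≡⟨ cong (XY u y *_) ([]+[not]≡1 (adj G u y)) ⟩
      XY u y * 1                                              ≡⟨ *-identityʳ (XY u y) ⟩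
      XY u y                                                  ∎

  nonEdges-comm : ∀ X Y → nonEdges X Y ≡ nonEdges Y X
  nonEdges-comm X Y = trans (∑-comm (λ u y → [ X u ] * [ Y y ] * [ not (adj G u y) ])) (sum₂-cong λ y u →
    cong₂ (λ m b → m * [ not b ]) (*-comm [ X u ] [ Y y ]) (Graph.sym G u y))

  nonEdges-rows : ∀ X Y → nonEdges X Y ≡ sum λ u → [ X u ] * count (Y ∖ adj G u)
  nonEdges-rows X Y = sum-cong-≗ λ u → begin
    sum (λ y → [ X u ] * [ Y y ] * [ not (adj G u y) ])   ≡⟨ sum-cong-≗ (row u) ⟩
    sum (λ y → [ X u ] * [ (Y ∖ adj G u) y ])             ≡⟨ *-distribˡ-sum [ X u ] (λ y → [ (Y ∖ adj G u) y ]) ⟨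
    [ X u ] * count (Y ∖ adj G u)                         ∎
    where
    open ≡-Reasoning
    row : ∀ u y → [ X u ] * [ Y y ] * [ not (adj G u y) ] ≡ [ X u ] * [ (Y ∖ adj G u) y ]
    row u y = trans (*-assoc [ X u ] [ Y y ] [ not (adj G u y) ])
                    (cong ([ X u ] *_) (sym ([∧]≡[]*[] (Y y) (not (adj G u y)))))

  edges-nbhd≡2*k3degree : ∀ v → edges (adj G v) (adj G v) ≡ 2 * k3degree G v
  edges-nbhd≡2*k3degree v = begin
    edges (adj G v) (adj G v)             ≡⟨ sum₂-cong both-orders ⟩
    sum₂ (λ j k → t j k + t k j)          ≡⟨ sum₂-distrib-+ t (λ j k → t k j) ⟩
    sum₂ t + sum₂ (λ j k → t k j)         ≡⟨ cong (sum₂ t +_) (∑-comm t) ⟨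
    sum₂ t + sum₂ t                       ≡⟨ cong (λ m → m + m) sum₂t≡k3degree ⟩
    k3degree G v + k3degree G v           ≡⟨ cong (k3degree G v +_) (+-identityʳ _) ⟨
    2 * k3degree G v                      ∎
    where
    open ≡-Reasoning
    t : Fin n → Fin n → ℕ
    t j k = [ ⌊ j <? k ⌋ ∧ adj G v j ∧ adj G v k ∧ adj G j k ]
    sum₂t≡k3degree : sum₂ t ≡ k3degree G v
    sum₂t≡k3degree = sym (trans (∑≡sum n _) (sum-cong-≗ λ j → ∑≡sum n (t j)))
    both-orders : ∀ j k → [ adj G v j ] * [ adj G v k ] * [ adj G j k ] ≡ t j k + t k j
    both-orders j k with j <? k | k <? j
    ... | yes j<k | yes k<j = contradiction k<j (<-asym j<k)
    ... | yes _   | no _    = trans (sym ([∧∧]≡[]*[]*[] a b c)) (sym (+-identityʳ [ a ∧ b ∧ c ]))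
      where a = adj G v j; b = adj G v k; c = adj G j k
    ... | no _    | yes _   = begin
      [ a ] * [ b ] * [ c ]        ≡⟨ cong (_* [ c ]) (*-comm [ a ] [ b ]) ⟩
      [ b ] * [ a ] * [ c ]        ≡⟨ [∧∧]≡[]*[]*[] b a c ⟨
      [ b ∧ a ∧ c ]                ≡⟨ cong (λ c → [ b ∧ a ∧ c ]) (Graph.sym G j k) ⟩
      [ b ∧ a ∧ adj G k j ]        ∎
      where a = adj G v j; b = adj G v k; c = adj G j k
    ... | no j≮k  | no k≮j  with <-cmp j k
    ...   | tri< j<k _ _ = contradiction j<k j≮k
    ...   | tri> _ _ k<j = contradiction k<j k≮j
    ...   | tri≈ _ refl _ = trans (cong ([ adj G v j ] * [ adj G v j ] *_) (cong [_] (Graph.irrefl G j)))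
                                  (*-zeroʳ ([ adj G v j ] * [ adj G v j ]))

-- The neighbourhoods of an edge

common exclusive : ∀ {n} → Graph n → Fin n → Fin n → ℕ
common    G v x = count (adj G v ∩ adj G x)
exclusive G v x = count (adj G v ∖ adj G x)

missing : ∀ {n} → Graph n → Fin n → ℕ
missing G v = nonEdges G (adj G v) (adj G v)

missing-pair-split : ∀ {n} (G : Graph n) v x →
  missing G v + missing G x ≡
  2 * nonEdges G (adj G v ∩ adj G x) (adj G v ∪ adj G x)
    + nonEdges G (adj G v ∖ adj G x) (adj G v ∖ adj G x)
    + nonEdges G (adj G x ∖ adj G v) (adj G x ∖ adj G v)
missing-pair-split G v x = begin
  missing G v + missing G x
    ≡⟨ sum₂-distrib-+ (λ u y → [ p u ] * [ p y ] * m u y) (λ u y → [ q u ] * [ q y ] * m u y) ⟨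
  sum₂ (λ u y → [ p u ] * [ p y ] * m u y + [ q u ] * [ q y ] * m u y)
    ≡⟨ sum₂-cong pointwise ⟩
  sum₂ (λ u y → IU u y + UI u y + AA u y + BB u y)
    ≡⟨ sum₂-distrib-+ (λ u y → IU u y + UI u y + AA u y) BB ⟩
  sum₂ (λ u y → IU u y + UI u y + AA u y) + sum₂ BB
    ≡⟨ cong (_+ sum₂ BB) (sum₂-distrib-+ (λ u y → IU u y + UI u y) AA) ⟩
  sum₂ (λ u y → IU u y + UI u y) + sum₂ AA + sum₂ BB
    ≡⟨ cong (λ k → k + sum₂ AA + sum₂ BB) (sum₂-distrib-+ IU UI) ⟩
  sum₂ IU + sum₂ UI + sum₂ AA + sum₂ BB
    ≡⟨ cong (λ k → sum₂ IU + k + sum₂ AA + sum₂ BB) (nonEdges-comm G U I) ⟩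
  sum₂ IU + sum₂ IU + sum₂ AA + sum₂ BB
    ≡⟨ cong (λ k → sum₂ IU + k + sum₂ AA + sum₂ BB) (+-identityʳ (sum₂ IU)) ⟨
  2 * sum₂ IU + sum₂ AA + sum₂ BB
    ∎
  where
  open ≡-Reasoning
  p q I U A B : Subset _
  p = adj G v
  q = adj G x
  I = p ∩ q
  U = p ∪ q
  A = p ∖ q
  B = q ∖ p
  m : _ → _ → ℕ
  m u y = [ not (adj G u y) ]
  IU UI AA BB : _ → _ → ℕ
  IU u y = [ I u ] * [ U y ] * m u y
  UI u y = [ U u ] * [ I y ] * m u y
  AA u y = [ A u ] * [ A y ] * m u y
  BB u y = [ B u ] * [ B y ] * m u y
  p≡I+A : ∀ u → [ p u ] ≡ [ I u ] + [ A u ]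
  p≡I+A u = []≡[∧]+[∧not] (p u) (q u)
  q≡I+B : ∀ u → [ q u ] ≡ [ I u ] + [ B u ]
  q≡I+B u = trans ([]≡[∧]+[∧not] (q u) (p u)) (cong (λ b → [ b ] + [ B u ]) (∧-comm (q u) (p u)))
  U≡I+A+B : ∀ u → [ U u ] ≡ [ I u ] + [ A u ] + [ B u ]
  U≡I+A+B u = [∨]≡[∧]+[∧not]+[∧not] (p u) (q u)
  expand : ∀ i a b i′ a′ b′ k →
    (i + a) * (i′ + a′) * k + (i + b) * (i′ + b′) * k ≡
    i * (i′ + a′ + b′) * k + (i + a + b) * i′ * k + a * a′ * k + b * b′ * k
  expand = solve-∀
  pointwise : ∀ u y → [ p u ] * [ p y ] * m u y + [ q u ] * [ q y ] * m u y ≡ IU u y + UI u y + AA u y + BB u y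
  pointwise u y = begin
    [ p u ] * [ p y ] * m u y + [ q u ] * [ q y ] * m u y
      ≡⟨ cong₂ _+_ (cong₂ (λ i j → i * j * m u y) (p≡I+A u) (p≡I+A y))
                   (cong₂ (λ i j → i * j * m u y) (q≡I+B u) (q≡I+B y)) ⟩
    ([ I u ] + [ A u ]) * ([ I y ] + [ A y ]) * m u y + ([ I u ] + [ B u ]) * ([ I y ] + [ B y ]) * m u y
      ≡⟨ expand [ I u ] [ A u ] [ B u ] [ I y ] [ A y ] [ B y ] (m u y) ⟩
    [ I u ] * ([ I y ] + [ A y ] + [ B y ]) * m u y + ([ I u ] + [ A u ] + [ B u ]) * [ I y ] * m u y
      + AA u y + BB u y
      ≡⟨ cong (λ k → k + AA u y + BB u y) (cong₂ _+_ (cong (λ i → [ I u ] * i * m u y) (U≡I+A+B y))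
                                                    (cong (λ i → i * [ I y ] * m u y) (U≡I+A+B u))) ⟨
    IU u y + UI u y + AA u y + BB u y
      ∎

-- x belongs to N(v) ∖ N(x) and misses all of it; every other member misses itself and x.
3*exclusive≤nonEdges+2 : ∀ {n} (G : Graph n) {v x} → adj G v x ≡ true →
  3 * exclusive G v x ≤ nonEdges G (adj G v ∖ adj G x) (adj G v ∖ adj G x) + 2
3*exclusive≤nonEdges+2 {suc n} G {v} {x} v~x = begin
  3 * count A                          ≡⟨ cong (3 *_) count-A ⟩
  3 * (1 + R)                          ≡⟨ regroup R ⟩
  (1 + R) + R * 2 + 2                  ≡⟨ cong (λ k → k + R * 2 + 2) count-A ⟨
  count A + R * 2 + 2                  ≤⟨ +-monoˡ-≤ 2 (+-mono-≤ (≤-reflexive (sym row-x)) rows-≠x) ⟩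
  row x + sum (row ∘ punchIn x) + 2    ≡⟨ cong (_+ 2) (sum-remove {i = x} row) ⟨
  sum row + 2                          ≡⟨ cong (_+ 2) (nonEdges-rows G A A) ⟨
  nonEdges G A A + 2                   ∎
  where
  open ≤-Reasoning
  A : Subset (suc n)
  A = adj G v ∖ adj G x
  R = count (A ∘ punchIn x)
  row : Fin (suc n) → ℕ
  row u = [ A u ] * count (A ∖ adj G u)
  x∈A : A x ≡ true
  x∈A = cong₂ (λ a b → a ∧ not b) v~x (Graph.irrefl G x)
  count-A : count A ≡ 1 + R
  count-A = trans (sum-remove {i = x} (λ u → [ A u ])) (cong (λ b → [ b ] + R) x∈A)
  A∖Nx≡A : ∀ u → (A ∖ adj G x) u ≡ A u
  A∖Nx≡A u = trans (∧-assoc (adj G v u) _ _) (cong (adj G v u ∧_) (∧-idem (not (adj G x u))))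
  row-x : row x ≡ count A
  row-x = trans (cong (λ b → [ b ] * count (A ∖ adj G x)) x∈A)
                (trans (+-identityʳ _) (sum-cong-≗ λ u → cong [_] (A∖Nx≡A u)))
  ∧-not≡true⇒false : ∀ {a b} → a ∧ not b ≡ true → b ≡ false
  ∧-not≡true⇒false {true} {false} _ = refl
  2≤row : ∀ k → [ A (punchIn x k) ] * 2 ≤ row (punchIn x k)
  2≤row k = []*-monoʳ-≤ (A u) λ u∈A → count-two {X = A ∖ adj G u} (punchInᵢ≢i x k)
    (cong₂ (λ a b → a ∧ not b) u∈A (Graph.irrefl G u))
    (cong₂ (λ a b → a ∧ not b) x∈A (trans (Graph.sym G u x) (∧-not≡true⇒false u∈A)))
    where u = punchIn x k
  rows-≠x : R * 2 ≤ sum (row ∘ punchIn x)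
  rows-≠x = ≤-trans (≤-reflexive (*-distribʳ-sum 2 (λ k → [ A (punchIn x k) ]))) (sum-mono-≤ 2≤row)
  regroup : ∀ r → 3 * (1 + r) ≡ (1 + r) + r * 2 + 2
  regroup = solve-∀

module Regular {n} (G : Graph n) {d} (regular : ∀ v → count (adj G v) ≡ d) where

  common+exclusive : ∀ v x → common G v x + exclusive G v x ≡ d
  common+exclusive v x = trans (count-∩+∖ (adj G v) (adj G x)) (regular v)

  exclusive-comm : ∀ v x → exclusive G x v ≡ exclusive G v x
  exclusive-comm v x = +-cancelˡ-≡ (common G v x) _ _ (begin
    common G v x + exclusive G x v
      ≡⟨ cong (_+ exclusive G x v) (sum-cong-≗ λ u → cong [_] (∧-comm (adj G v u) (adj G x u))) ⟩
    common G x v + exclusive G x v   ≡⟨ common+exclusive x v ⟩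
    d                                ≡⟨ common+exclusive v x ⟨
    common G v x + exclusive G v x   ∎)
    where open ≡-Reasoning

  common*exclusive≤nonEdges : ∀ v x →
    common G v x * exclusive G v x ≤ nonEdges G (adj G v ∩ adj G x) (adj G v ∪ adj G x)
  common*exclusive≤nonEdges v x = begin
    count I * P                                ≡⟨ *-distribʳ-sum P (λ u → [ I u ]) ⟩
    sum (λ u → [ I u ] * P)                    ≤⟨ sum-mono-≤ (λ u → []*-monoʳ-≤ (I u) λ _ → P≤row u) ⟩
    sum (λ u → [ I u ] * count (U ∖ adj G u))  ≡⟨ nonEdges-rows G I U ⟨
    nonEdges G I U                             ∎
    where
    open ≤-Reasoning
    I U : Subset n
    I = adj G v ∩ adj G x
    U = adj G v ∪ adj G x
    P = exclusive G v x
    count-U : count U ≡ P + d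
    count-U = begin-equality
      count U                               ≡⟨ count-∪ (adj G v) (adj G x) ⟩
      common G v x + P + exclusive G x v    ≡⟨ cong₂ _+_ (common+exclusive v x) (exclusive-comm v x) ⟩
      d + P                                 ≡⟨ +-comm d P ⟩
      P + d                                 ∎
    P≤row : ∀ u → P ≤ count (U ∖ adj G u)
    P≤row u = +-cancelʳ-≤ d P _ (begin
      P + d                                  ≡⟨ count-U ⟨
      count U                                ≤⟨ count-≤-∖+ U (adj G u) ⟩
      count (U ∖ adj G u) + count (adj G u)  ≡⟨ cong (count (U ∖ adj G u) +_) (regular u) ⟩
      count (U ∖ adj G u) + d                ∎)

  missing-pair-lower-bound : ∀ {v x} → adj G v x ≡ true →
    2 * (exclusive G v x * (common G v x + 3)) ≤ missing G v + missing G x + 4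
  missing-pair-lower-bound {v} {x} v~x = begin
    2 * (P * (L + 3))                  ≡⟨ regroup P L ⟩
    2 * (L * P) + 3 * P + 3 * P        ≤⟨ +-mono-≤ (+-mono-≤ (*-monoʳ-≤ 2 (common*exclusive≤nonEdges v x))
                                                            (3*exclusive≤nonEdges+2 G v~x))
                                                  3P≤nBB+2 ⟩
    2 * nIU + (nAA + 2) + (nBB + 2)    ≡⟨ regroup′ nIU nAA nBB ⟩
    (2 * nIU + nAA + nBB) + 4          ≡⟨ cong (_+ 4) (missing-pair-split G v x) ⟨
    missing G v + missing G x + 4      ∎
    where
    open ≤-Reasoning
    P = exclusive G v x
    L = common G v x
    nIU = nonEdges G (adj G v ∩ adj G x) (adj G v ∪ adj G x)
    nAA = nonEdges G (adj G v ∖ adj G x) (adj G v ∖ adj G x)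
    nBB = nonEdges G (adj G x ∖ adj G v) (adj G x ∖ adj G v)
    3P≤nBB+2 : 3 * P ≤ nBB + 2
    3P≤nBB+2 = ≤-trans (≤-reflexive (cong (3 *_) (sym (exclusive-comm v x))))
                       (3*exclusive≤nonEdges+2 G (trans (Graph.sym G x v) v~x))
    regroup : ∀ p l → 2 * (p * (l + 3)) ≡ 2 * (l * p) + 3 * p + 3 * p
    regroup = solve-∀
    regroup′ : ∀ a b c → 2 * a + (b + 2) + (c + 2) ≡ (2 * a + b + c) + 4
    regroup′ = solve-∀

  missing+2*k3degree : ∀ v → missing G v + 2 * k3degree G v ≡ d * d
  missing+2*k3degree v = begin
    missing G v + 2 * k3degree G v               ≡⟨ +-comm (missing G v) _ ⟩
    2 * k3degree G v + missing G v               ≡⟨ cong (_+ missing G v) (edges-nbhd≡2*k3degree G v) ⟨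
    edges G (adj G v) (adj G v) + missing G v    ≡⟨ edges+nonEdges G (adj G v) (adj G v) ⟩
    count (adj G v) * count (adj G v)            ≡⟨ cong₂ _*_ (regular v) (regular v) ⟩
    d * d                                        ∎
    where open ≡-Reasoning

-- The gap

[d+1]*P≤W+1 : ∀ {L P W d} → L + P ≡ d → 1 ≤ P → P * (L + 3) ≤ W + 2 → W ≢ 2 * d → W + 4 ≤ 3 * d →
  (d + 1) * P ≤ W + 1
[d+1]*P≤W+1 {L} {1} {W} refl _ bound _ _ = +-cancelʳ-≤ 1 _ _ (begin
  (L + 1 + 1) * 1 + 1      ≡⟨ regroup L ⟩
  1 * (L + 3)              ≤⟨ bound ⟩
  W + 2                    ≡⟨ +-assoc W 1 1 ⟨
  W + 1 + 1                ∎)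
  where
  open ≤-Reasoning
  regroup : ∀ l → (l + 1 + 1) * 1 + 1 ≡ 1 * (l + 3)
  regroup = solve-∀
[d+1]*P≤W+1 {L} {2} {W} refl _ bound W≢2d _ = begin
  (L + 2 + 1) * 2          ≡⟨ regroup L ⟩
  suc (2 * (L + 2)) + 1    ≤⟨ +-monoˡ-≤ 1 (≤∧≢⇒< 2[L+2]≤W (W≢2d ∘ sym)) ⟩
  W + 1                    ∎
  where
  open ≤-Reasoning
  regroup : ∀ l → (l + 2 + 1) * 2 ≡ suc (2 * (l + 2)) + 1
  regroup = solve-∀
  regroup′ : ∀ l → 2 * (l + 2) + 2 ≡ 2 * (l + 3)
  regroup′ = solve-∀
  2[L+2]≤W : 2 * (L + 2) ≤ W
  2[L+2]≤W = +-cancelʳ-≤ 2 _ _ (≤-trans (≤-reflexive (regroup′ L)) bound)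
[d+1]*P≤W+1 {L} {suc (suc (suc k))} {W} refl _ bound _ W+4≤3d = contradiction (begin-strict
  3 * d                    <⟨ m<m+n (3 * d) z<s ⟩
  3 * d + (2 + k * L)      ≡⟨ regroup L k ⟩
  P * (L + 3) + 2          ≤⟨ +-monoˡ-≤ 2 bound ⟩
  W + 2 + 2                ≡⟨ +-assoc W 2 2 ⟩
  W + 4                    ≤⟨ W+4≤3d ⟩
  3 * d                    ∎) (<-irrefl refl)
  where
  open ≤-Reasoning
  P = suc (suc (suc k))
  d = L + P
  regroup : ∀ l k → 3 * (l + suc (suc (suc k))) + (2 + k * l) ≡ suc (suc (suc k)) * (l + 3) + 2
  regroup = solve-∀

missing≤degree : ∀ {n d W} (G : Graph (suc n)) → (∀ v → count (adj G v) ≡ d) →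
  (∀ v → missing G v ≡ W) → (∀ m → W ≢ 2 * m) → W + 4 ≤ 3 * d → W ≤ d
missing≤degree {n} {d} {W} G regular missing≡W W-odd W+4≤3d = +-cancelˡ-≤ (d * W) _ _ (begin
  d * W + W                                ≡⟨ regroup d W ⟩
  (d + 1) * W                              ≡⟨ cong ((d + 1) *_) rows ⟨
  (d + 1) * sum (λ u → [ p u ] * P u)      ≡⟨ *-distribˡ-sum (d + 1) (λ u → [ p u ] * P u) ⟩
  sum (λ u → (d + 1) * ([ p u ] * P u))    ≡⟨ sum-cong-≗ (λ u → swap (d + 1) [ p u ] (P u)) ⟩
  sum (λ u → [ p u ] * ((d + 1) * P u))    ≤⟨ sum-mono-≤ (λ u → []*-monoʳ-≤ (p u) (neighbour u)) ⟩
  sum (λ u → [ p u ] * (W + 1))            ≡⟨ *-distribʳ-sum (W + 1) (λ u → [ p u ]) ⟨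
  count p * (W + 1)                        ≡⟨ cong (_* (W + 1)) (regular zero) ⟩
  d * (W + 1)                              ≡⟨ *-distribˡ-+ d W 1 ⟩
  d * W + d * 1                            ≡⟨ cong (d * W +_) (*-identityʳ d) ⟩
  d * W + d                                ∎)
  where
  open ≤-Reasoning
  open Regular G regular
  p = adj G zero
  P : Fin (suc n) → ℕ
  P = exclusive G zero
  rows : sum (λ u → [ p u ] * P u) ≡ W
  rows = trans (sym (nonEdges-rows G p p)) (missing≡W zero)
  P[L+3]≤W+2 : ∀ {u} → p u ≡ true → P u * (common G zero u + 3) ≤ W + 2
  P[L+3]≤W+2 {u} 0~u = *-cancelˡ-≤ 2 (begin
    2 * (P u * (common G zero u + 3))    ≤⟨ missing-pair-lower-bound 0~u ⟩
    missing G zero + missing G u + 4     ≡⟨ cong₂ (λ a b → a + b + 4) (missing≡W zero) (missing≡W u) ⟩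
    W + W + 4                            ≡⟨ regroup′ W ⟩
    2 * (W + 2)                          ∎)
    where
    regroup′ : ∀ w → w + w + 4 ≡ 2 * (w + 2)
    regroup′ = solve-∀
  neighbour : ∀ u → p u ≡ true → (d + 1) * P u ≤ W + 1
  neighbour u 0~u = [d+1]*P≤W+1 (common+exclusive zero u) 1≤P (P[L+3]≤W+2 0~u) (W-odd d) W+4≤3d
    where
    1≤P : 1 ≤ P u
    1≤P = ≤-trans (≤-reflexive (sym (cong₂ (λ a b → [ a ∧ not b ]) 0~u (Graph.irrefl G u))))
                  (≤-sum (λ y → [ (p ∖ adj G u) y ]) u)
  regroup : ∀ d w → d * w + w ≡ (d + 1) * w
  regroup = solve-∀
  swap : ∀ a b c → a * (b * c) ≡ b * (a * c)
  swap = solve-∀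

2*nC2+n≡n*n : ∀ n → 2 * (n C 2) + n ≡ n * n
2*nC2+n≡n*n zero    = refl
2*nC2+n≡n*n (suc n) = begin
  2 * (suc n C 2) + suc n            ≡⟨ cong (λ c → 2 * c + suc n) (nCk+nC[k+1]≡[n+1]C[k+1] n 1) ⟨
  2 * (n C 1 + n C 2) + suc n        ≡⟨ cong (λ c → 2 * (c + n C 2) + suc n) (nC1≡n n) ⟩
  2 * (n + n C 2) + suc n            ≡⟨ regroup n (n C 2) ⟩
  (2 * (n C 2) + n) + (2 * n + 1)    ≡⟨ cong (_+ (2 * n + 1)) (2*nC2+n≡n*n n) ⟩
  n * n + (2 * n + 1)                ≡⟨ square n ⟩
  suc n * suc n                      ∎
  where
  open ≡-Reasoning
  regroup : ∀ n c → 2 * (n + c) + suc n ≡ (2 * c + n) + (2 * n + 1)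
  regroup = solve-∀
  square : ∀ n → n * n + (2 * n + 1) ≡ suc n * suc n
  square = solve-∀

no-graph-in-gap : ∀ {e k r₃} → suc e ≡ 2 * k + 1 → e C 2 < r₃ → r₃ < suc e C 2 →
  ∀ {n} (G : Graph (suc n)) → ¬ HasParams G (suc e) r₃
no-graph-in-gap {e} {k} {r₃} d-odd lo hi G params =
  <⇒≱ d<W (missing≤degree G regular missing≡W W-odd W+4≤3d)
  where
  d = suc e
  regular : ∀ v → count (adj G v) ≡ d
  regular v = trans (sym (∑≡sum _ (λ j → [ adj G v j ]))) (proj₁ (params v))
  open Regular G regular using (missing+2*k3degree)
  W = missing G zero
  missing+2r₃ : ∀ v → missing G v + 2 * r₃ ≡ d * d
  missing+2r₃ v = trans (cong (λ t → missing G v + 2 * t) (sym (proj₂ (params v)))) (missing+2*k3degree v)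
  missing≡W : ∀ v → missing G v ≡ W
  missing≡W v = +-cancelʳ-≡ (2 * r₃) _ _ (trans (missing+2r₃ v) (sym (missing+2r₃ zero)))
  W-odd : ∀ m → W ≢ 2 * m
  W-odd m W≡2m = even≢odd (m + r₃) (2 * (k * k) + 2 * k) (begin
    2 * (m + r₃)                      ≡⟨ *-distribˡ-+ 2 m r₃ ⟩
    2 * m + 2 * r₃                    ≡⟨ cong (_+ 2 * r₃) W≡2m ⟨
    W + 2 * r₃                        ≡⟨ missing+2r₃ zero ⟩
    d * d                             ≡⟨ cong₂ _*_ d-odd d-odd ⟩
    (2 * k + 1) * (2 * k + 1)         ≡⟨ square k ⟩
    suc (2 * (2 * (k * k) + 2 * k))   ∎)
    where
    open ≡-Reasoning
    square : ∀ k → (2 * k + 1) * (2 * k + 1) ≡ suc (2 * (2 * (k * k) + 2 * k))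
    square = solve-∀
  d<W : d < W
  d<W = +-cancelʳ-≤ (2 * r₃) _ _ (begin
    suc d + 2 * r₃                    ≤⟨ m≤n+m (suc d + 2 * r₃) 1 ⟩
    1 + (suc d + 2 * r₃)              ≡⟨ regroup d r₃ ⟩
    2 * suc r₃ + d                    ≤⟨ +-monoˡ-≤ d (*-monoʳ-≤ 2 hi) ⟩
    2 * (d C 2) + d                   ≡⟨ 2*nC2+n≡n*n d ⟩
    d * d                             ≡⟨ missing+2r₃ zero ⟨
    W + 2 * r₃                        ∎)
    where
    open ≤-Reasoning
    regroup : ∀ d r → 1 + (suc d + 2 * r) ≡ 2 * suc r + d
    regroup = solve-∀
  W+4≤3d : W + 4 ≤ 3 * d
  W+4≤3d = +-cancelʳ-≤ (2 * (e C 2)) _ _ (begin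
    W + 4 + 2 * (e C 2)               ≡⟨ regroup W (e C 2) ⟩
    W + 2 * suc (e C 2) + 2           ≤⟨ +-monoˡ-≤ 2 (+-monoʳ-≤ W (*-monoʳ-≤ 2 lo)) ⟩
    W + 2 * r₃ + 2                    ≡⟨ cong (_+ 2) (missing+2r₃ zero) ⟩
    d * d + 2                         ≡⟨ square e ⟩
    e * e + (2 * e + 3)               ≡⟨ cong (_+ (2 * e + 3)) (2*nC2+n≡n*n e) ⟨
    2 * (e C 2) + e + (2 * e + 3)     ≡⟨ regroup′ (e C 2) e ⟩
    3 * d + 2 * (e C 2)               ∎)
    where
    open ≤-Reasoning
    regroup : ∀ w c → w + 4 + 2 * c ≡ w + 2 * suc c + 2
    regroup = solve-∀
    square : ∀ e → suc e * suc e + 2 ≡ e * e + (2 * e + 3)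
    square = solve-∀
    regroup′ : ∀ c e → 2 * c + e + (2 * e + 3) ≡ 3 * suc e + 2 * c
    regroup′ = solve-∀

-- Complete graphs

nonEdges-K : ∀ {m} (X : Subset m) → nonEdges (K m) X X ≡ count X
nonEdges-K X = sum-cong-≗ λ u → begin
  sum (λ y → [ X u ] * [ X y ] * [ not (not ⌊ u ≟ y ⌋) ])   ≡⟨ sum-cong-≗ (reorder u) ⟩
  sum (λ y → [ X u ] * δ u y)                                ≡⟨ *-distribˡ-sum [ X u ] (δ u) ⟨
  [ X u ] * sum (δ u)                                        ≡⟨ cong ([ X u ] *_) (sum-select u (λ y → [ X y ])) ⟩
  [ X u ] * [ X u ]                                          ≡⟨ []*[]≡[] (X u) ⟩
  [ X u ]                                                    ∎
  where
  open ≡-Reasoning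
  δ : _ → _ → ℕ
  δ u y = [ ⌊ u ≟ y ⌋ ] * [ X y ]
  reorder : ∀ u y → [ X u ] * [ X y ] * [ not (not ⌊ u ≟ y ⌋) ] ≡ [ X u ] * δ u y
  reorder u y = trans (cong (λ b → [ X u ] * [ X y ] * [ b ]) (not-involutive _))
                      (trans (*-assoc [ X u ] _ _) (cong ([ X u ] *_) (*-comm [ X y ] _)))

K-params : ∀ r → HasParams (K (suc r)) r (r C 2)
K-params r v = degree≡r , *-cancelˡ-≡ (k3degree (K (suc r)) v) (r C 2) 2 (+-cancelʳ-≡ r _ _ (begin
  2 * k3degree (K (suc r)) v + r
    ≡⟨ cong₂ _+_ (edges-nbhd≡2*k3degree (K (suc r)) v) (count-all-but v) ⟨
  edges (K (suc r)) N N + count N                      ≡⟨ cong (edges (K (suc r)) N N +_) (nonEdges-K N) ⟨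
  edges (K (suc r)) N N + nonEdges (K (suc r)) N N     ≡⟨ edges+nonEdges (K (suc r)) N N ⟩
  count N * count N                                    ≡⟨ cong₂ _*_ (count-all-but v) (count-all-but v) ⟩
  r * r                                                ≡⟨ 2*nC2+n≡n*n r ⟨
  2 * (r C 2) + r                                      ∎))
  where
  open ≡-Reasoning
  N = adj (K (suc r)) v
  degree≡r = trans (∑≡sum _ (λ j → [ N j ])) (count-all-but v)

-- Products with K₂

module _ {m} (G : Graph m) where

  layered : Fin m × Fin 2 → Fin m × Fin 2 → Bool
  layered (u , b) (u′ , b′) = if ⌊ b ≟ b′ ⌋ then adj G u u′ else ⌊ u ≟ u′ ⌋

  □K₂-adj : ∀ x y → adj (G □ K 2) x y ≡ layered (remQuot 2 x) (remQuot 2 y)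
  □K₂-adj x y = select (⌊ proj₁ (remQuot {m} 2 x) ≟ proj₁ (remQuot {m} 2 y) ⌋) _ _
    where
    select : ∀ e c g → (e ∧ not c) ∨ (c ∧ g) ≡ (if c then g else e)
    select e true  g = cong (_∨ g) (∧-zeroʳ e)
    select e false g = trans (∨-identityʳ (e ∧ true)) (∧-identityʳ e)

  layer-sum : ∀ u u′ b → sum (λ b′ → [ layered (u , b) (u′ , b′) ]) ≡ [ adj G u u′ ] + [ ⌊ u ≟ u′ ⌋ ]
  layer-sum u u′ zero       = cong ([ adj G u u′ ] +_) (+-identityʳ _)
  layer-sum u u′ (suc zero) =
    trans (cong ([ ⌊ u ≟ u′ ⌋ ] +_) (+-identityʳ _)) (+-comm [ ⌊ u ≟ u′ ⌋ ] [ adj G u u′ ])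

  private
    vanish : ∀ a b c → a ∧ b ∧ c ≡ false → [ a ] * [ b ] * [ c ] ≡ 0
    vanish a b c abc = trans (sym ([∧∧]≡[]*[]*[] a b c)) (cong [_] abc)

    adj-≟-≟ : ∀ u u₁ u₂ → adj G u u₁ ∧ ⌊ u ≟ u₂ ⌋ ∧ ⌊ u₁ ≟ u₂ ⌋ ≡ false
    adj-≟-≟ u u₁ u₂ with u ≟ u₂ | u₁ ≟ u₂
    ... | yes refl | yes refl = trans (∧-identityʳ _) (Graph.irrefl G u)
    ... | yes _    | no _     = ∧-zeroʳ _
    ... | no _     | _        = ∧-zeroʳ _

    ≟-adj-≟ : ∀ u u₁ u₂ → ⌊ u ≟ u₁ ⌋ ∧ adj G u u₂ ∧ ⌊ u₁ ≟ u₂ ⌋ ≡ false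
    ≟-adj-≟ u u₁ u₂ with u ≟ u₁ | u₁ ≟ u₂
    ... | yes refl | yes refl = trans (∧-identityʳ _) (Graph.irrefl G u)
    ... | yes _    | no _     = ∧-zeroʳ _
    ... | no _     | _        = refl

    ≟-≟-adj : ∀ u u₁ u₂ → ⌊ u ≟ u₁ ⌋ ∧ ⌊ u ≟ u₂ ⌋ ∧ adj G u₁ u₂ ≡ false
    ≟-≟-adj u u₁ u₂ with u ≟ u₁ | u ≟ u₂
    ... | yes refl | yes refl = Graph.irrefl G u
    ... | yes _    | no _     = refl
    ... | no _     | _        = refl

  triangle-layers : ∀ u u₁ u₂ b b₁ b₂ →
    [ layered (u , b) (u₁ , b₁) ] * [ layered (u , b) (u₂ , b₂) ] * [ layered (u₁ , b₁) (u₂ , b₂) ] ≡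
    [ ⌊ b ≟ b₁ ⌋ ] * ([ ⌊ b ≟ b₂ ⌋ ] * ([ adj G u u₁ ] * [ adj G u u₂ ] * [ adj G u₁ u₂ ]))
  triangle-layers u u₁ u₂ 0F 0F 0F = sym (trans (*-identityˡ _) (*-identityˡ _))
  triangle-layers u u₁ u₂ 0F 0F 1F = vanish (adj G u u₁) ⌊ u ≟ u₂ ⌋ ⌊ u₁ ≟ u₂ ⌋ (adj-≟-≟ u u₁ u₂)
  triangle-layers u u₁ u₂ 0F 1F 0F = vanish ⌊ u ≟ u₁ ⌋ (adj G u u₂) ⌊ u₁ ≟ u₂ ⌋ (≟-adj-≟ u u₁ u₂)
  triangle-layers u u₁ u₂ 0F 1F 1F = vanish ⌊ u ≟ u₁ ⌋ ⌊ u ≟ u₂ ⌋ (adj G u₁ u₂) (≟-≟-adj u u₁ u₂)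
  triangle-layers u u₁ u₂ 1F 0F 0F = vanish ⌊ u ≟ u₁ ⌋ ⌊ u ≟ u₂ ⌋ (adj G u₁ u₂) (≟-≟-adj u u₁ u₂)
  triangle-layers u u₁ u₂ 1F 0F 1F = vanish ⌊ u ≟ u₁ ⌋ (adj G u u₂) ⌊ u₁ ≟ u₂ ⌋ (≟-adj-≟ u u₁ u₂)
  triangle-layers u u₁ u₂ 1F 1F 0F = vanish (adj G u u₁) ⌊ u ≟ u₂ ⌋ ⌊ u₁ ≟ u₂ ⌋ (adj-≟-≟ u u₁ u₂)
  triangle-layers u u₁ u₂ 1F 1F 1F = sym (trans (*-identityˡ _) (*-identityˡ _))

  module _ (x : Fin (m * 2)) where

    private
      u = proj₁ (remQuot {m} 2 x)
      b = proj₂ (remQuot {m} 2 x)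
      N = adj (G □ K 2) x

    □K₂-degree : degree (G □ K 2) x ≡ suc (count (adj G u))
    □K₂-degree = begin
      degree (G □ K 2) x                                      ≡⟨ ∑≡sum (m * 2) (λ y → [ N y ]) ⟩
      sum (λ y → [ N y ])                                     ≡⟨ sum-cong-≗ (λ y → cong [_] (□K₂-adj x y)) ⟩
      sum (λ y → [ layered (u , b) (remQuot 2 y) ])           ≡⟨ sum-remQuot m (λ p → [ layered (u , b) p ]) ⟩
      sum (λ u′ → sum λ b′ → [ layered (u , b) (u′ , b′) ])   ≡⟨ sum-cong-≗ (λ u′ → layer-sum u u′ b) ⟩
      sum (λ u′ → [ adj G u u′ ] + [ ⌊ u ≟ u′ ⌋ ])            ≡⟨ ∑-distrib-+ (λ u′ → [ adj G u u′ ]) _ ⟩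
      count (adj G u) + count (λ u′ → ⌊ u ≟ u′ ⌋)            ≡⟨ cong (count (adj G u) +_) (count-singleton u) ⟩
      count (adj G u) + 1                                     ≡⟨ +-comm _ 1 ⟩
      suc (count (adj G u))                                   ∎
      where open ≡-Reasoning

    □K₂-edges-nbhd : edges (G □ K 2) N N ≡ edges G (adj G u) (adj G u)
    □K₂-edges-nbhd = begin
      edges (G □ K 2) N N
        ≡⟨ sum₂-cong (λ y z → cong₂ _*_ (cong₂ _*_ (cong [_] (□K₂-adj x y)) (cong [_] (□K₂-adj x z)))
                                         (cong [_] (□K₂-adj y z))) ⟩
      sum (λ y → sum λ z → F (remQuot 2 y) (remQuot 2 z))
        ≡⟨ sum-cong-≗ (λ y → sum-remQuot m (F (remQuot 2 y))) ⟩
      sum (λ y → sum λ u₂ → sum λ b₂ → F (remQuot 2 y) (u₂ , b₂))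
        ≡⟨ sum-remQuot m (λ p → sum λ u₂ → sum λ b₂ → F p (u₂ , b₂)) ⟩
      sum (λ u₁ → sum λ b₁ → sum λ u₂ → sum λ b₂ → F (u₁ , b₁) (u₂ , b₂))
        ≡⟨ sum-cong-≗ (λ u₁ → sum-cong-≗ λ b₁ → sum-cong-≗ λ u₂ → sum-cong-≗ (triangle-layers u u₁ u₂ b b₁)) ⟩
      sum (λ u₁ → sum λ b₁ → sum λ u₂ → sum λ b₂ → [ ⌊ b ≟ b₁ ⌋ ] * ([ ⌊ b ≟ b₂ ⌋ ] * T u₁ u₂))
        ≡⟨ sum-cong-≗ (λ u₁ → sum-cong-≗ λ b₁ → pull [ ⌊ b ≟ b₁ ⌋ ] (λ u₂ b₂ → [ ⌊ b ≟ b₂ ⌋ ] * T u₁ u₂)) ⟩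
      sum (λ u₁ → sum λ b₁ → [ ⌊ b ≟ b₁ ⌋ ] * Q u₁)
        ≡⟨ sum-cong-≗ (λ u₁ → sum-select b (λ _ → Q u₁)) ⟩
      sum Q
        ≡⟨ sum₂-cong (λ u₁ u₂ → sum-select b (λ _ → T u₁ u₂)) ⟩
      edges G (adj G u) (adj G u)
        ∎
      where
      open ≡-Reasoning
      F : Fin m × Fin 2 → Fin m × Fin 2 → ℕ
      F p q = [ layered (u , b) p ] * [ layered (u , b) q ] * [ layered p q ]
      T : Fin m → Fin m → ℕ
      T u₁ u₂ = [ adj G u u₁ ] * [ adj G u u₂ ] * [ adj G u₁ u₂ ]
      Q : Fin m → ℕ
      Q u₁ = sum λ u₂ → sum λ b₂ → [ ⌊ b ≟ b₂ ⌋ ] * T u₁ u₂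
      pull : ∀ c (f : Fin m → Fin 2 → ℕ) →
        sum (λ u₂ → sum λ b₂ → c * f u₂ b₂) ≡ c * sum (λ u₂ → sum λ b₂ → f u₂ b₂)
      pull c f = trans (sum-cong-≗ λ u₂ → sym (*-distribˡ-sum c (f u₂)))
                       (sym (*-distribˡ-sum c (λ u₂ → sum (f u₂))))

  □K₂-params : ∀ {r s} → HasParams G r s → HasParams (G □ K 2) (suc r) s
  □K₂-params {r} {s} params x = degree≡ , *-cancelˡ-≡ (k3degree (G □ K 2) x) s 2 (begin
    2 * k3degree (G □ K 2) x                               ≡⟨ edges-nbhd≡2*k3degree (G □ K 2) x ⟨
    edges (G □ K 2) (adj (G □ K 2) x) (adj (G □ K 2) x)    ≡⟨ □K₂-edges-nbhd x ⟩
    edges G (adj G u) (adj G u)                            ≡⟨ edges-nbhd≡2*k3degree G u ⟩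
    2 * k3degree G u                                       ≡⟨ cong (2 *_) (proj₂ (params u)) ⟩
    2 * s                                                  ∎)
    where
    open ≡-Reasoning
    u = proj₁ (remQuot {m} 2 x)
    degree≡ : degree (G □ K 2) x ≡ suc r
    degree≡ = trans (□K₂-degree x) (cong suc (trans (sym (∑≡sum m (λ j → [ adj G u j ]))) (proj₁ (params u))))

corollary5p2 : (r₂ : ℕ) → 3 ≤ r₂ → (∃ λ k → r₂ ≡ 2 * k + 1) →
    ((r₃ : ℕ) → ((r₂ ∸ 1) C 2) < r₃ → r₃ < (r₂ C 2) →
      (n : ℕ) → 1 ≤ n → (G : Graph n) → ¬ HasParams G r₂ r₃)
    × HasParams (K (suc r₂)) r₂ (r₂ C 2)
    × HasParams (K r₂ □ K 2) r₂ ((r₂ ∸ 1) C 2)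
corollary5p2 (suc r) _ (k , r₂-odd) = gap , K-params (suc r) , □K₂-params (K (suc r)) (K-params r)
  where
  gap : ∀ r₃ → r C 2 < r₃ → r₃ < suc r C 2 → ∀ n → 1 ≤ n → (G : Graph n) → ¬ HasParams G (suc r) r₃
  gap r₃ lo hi (suc n) _ G = no-graph-in-gap {k = k} r₂-odd lo hi G
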